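{- Let $\mathbf{L}$ be either $\mathbf{P}[\bot]$ or $\mathbf{P}[\bot_w]$, and let $I=\langle\mathcal A,v\rangle$ be a plain interpretation of $\mathbf{L}$. For every set $\Gamma$ of infons there exists an $\mathbf{L}$-closed set $M$ with $v(\Gamma)\subseteq M$ such that for every infon $\varphi$, if $\Gamma\not\vdash\varphi$ in $\mathbf{L}$ then $v(\varphi)\notin M$.
   Context: Infons: fix a set $At$ of atomic infons; infons are generated by $\varphi ::= \top\mid\bot \mid At \mid (\varphi\wedge\varphi)\mid(\varphi\to\varphi)$. Basic rules: from $\varphi_1,\varphi_2$ infer $\varphi_1\wedge\varphi_2$; from $\varphi_1\wedge\varphi_2$ infer $\varphi_i$ ($i=1,2$); from $\varphi_2$ infer $\varphi_1\to\varphi_2$; from $\varphi_1$ and $\varphi_1\to\varphi_2$ infer $\varphi_2$. $\mathbf{P}[\bot]$ adds: from $\bot$ infer any $\varphi$. $\mathbf{P}[\bot_w]$ instead adds: from $\bot$ and $\varphi\to\psi$ infer $\psi$. In $\mathbf{L}$, $\Gamma\vdash\varphi$ iff there is a finite sequence ending in $\varphi$ whose members are in $\Gamma\cup\{\top\}$ or follow from earlier members by the rules of $\mathbf{L}$; $T$ is deductively closed in $\mathbf{L}$ if $T\vdash\psi$ implies $\psi\in T$. Infon algebras: $\Sigma=\{0,1\}$, $\mathsf f\notin\Sigma$, $\Sigma_\bot=\Sigma\cup\{\mathsf f\}$. $\mathcal A=\langle\Sigma_\bot^*,\pi,l,r,\mathrm{enc},\mathrm{dec},E\rangle$ with $\pi,\mathrm{enc}:(\Sigma_\bot^*)^2\to\Sigma_\bot^*$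 total, $l,r,\mathrm{dec}$ partial, $l(\pi(x,y))=x$, $r(\pi(x,y))=y$, $\mathrm{dec}(x,\mathrm{enc}(x,y))=y$ defined and valid for all $x,y$, all functions mapping arguments in $\Sigma^*$ to values in $\Sigma^*$, and $\emptyset\ne E\subseteq\Sigma^*$; for $\mathbf{P}[\bot_w]$ additionally a partial operation $\mathrm{crack}$ with $\mathrm{crack}(\mathsf f,\mathrm{enc}(a,b))=b$. An interpretation is $I=\langle\mathcal A,v\rangle$ with $v:At\cup\{\top,\bot\}\to\Sigma_\bot^*$, $v(\bot)=\mathsf f$, $v(\top)\in E$, $v(p)\in\Sigma^*$ for $p\in At$, extended by $v(\varphi_1\wedge\varphi_2)=\pi(v(\varphi_1),v(\varphi_2))$, $v(\varphi_1\to\varphi_2)=\mathrm{enc}(v(\varphi_1),v(\varphi_2))$, $v(\Gamma)=\{v(\psi):\psi\in\Gamma\}$. $M\subseteq\Sigma_\bot^*$ is $\mathbf{L}$-closed if $E\subseteq M$ and for all $a,b\in\Sigma_\bot^*$: (1) $a,b\in M\iff\pi(a,b)\in M$; (2) $a,\mathrm{enc}(a,b)\in M\Rightarrow b\in M$; (3) $b\in M\Rightarrow\mathrm{enc}(a,b)\in M$; for $\mathbf{P}[\bot]$: (4) $\mathsf f\in M$ implies $M=\Sigma_\bot^*$; for $\mathbf{P}[\bot_w]$: (4') $\mathsf f\in M$ and $\mathrm{enc}(a,b)\in M$ imply $b\in M$. The interpretation is plain for $\mathbf{L}$ if it is injective ($v(\varphi_1)=v(\varphi_2)$ implies $\varphi_1=\varphi_2$)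 and conservative (for every set $T$ deductively closed in $\mathbf{L}$, the least $\mathbf{L}$-closed set containing $v(T)$ contains no string $v(\psi)$ with $\psi\notin T$). -}

module Defs where

open import Data.List using (List; _∷_; [])
open import Data.List.Relation.Unary.All using (All)
open import Data.Maybe using (Maybe; just)
open import Data.Product using (Σ; ∃; _×_; _,_)
open import Data.Unit using (⊤)
open import Relation.Binary.PropositionalEquality using (_≡_)
open import Relation.Nullary using (¬_)
open import Function.Bundles using (_⇔_)

data Logic : Set where
  P⊥  : Logic
  P⊥w : Logic

data Infon (At : Set) : Set where
  ⊤ᵢ   : Infon At
  ⊥ᵢ   : Infon At
  atom : At → Infon At
  _∧ᵢ_ : Infon At → Infon At → Infon At
  _⇒ᵢ_ : Infon At → Infon At → Infon At

-- Derivability Γ ⊢ φ in L (derivation trees; equivalent to finite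
-- derivation sequences whose members are in Γ ∪ {⊤} or follow by a rule).
data Derivable {At : Set} (L : Logic) (Γ : Infon At → Set) : Infon At → Set where
  hyp   : ∀ {φ} → Γ φ → Derivable L Γ φ
  top   : Derivable L Γ ⊤ᵢ
  ∧-I   : ∀ {φ ψ} → Derivable L Γ φ → Derivable L Γ ψ → Derivable L Γ (φ ∧ᵢ ψ)
  ∧-E₁  : ∀ {φ ψ} → Derivable L Γ (φ ∧ᵢ ψ) → Derivable L Γ φ
  ∧-E₂  : ∀ {φ ψ} → Derivable L Γ (φ ∧ᵢ ψ) → Derivable L Γ ψ
  ⇒-I   : ∀ {φ ψ} → Derivable L Γ ψ → Derivable L Γ (φ ⇒ᵢ ψ)
  ⇒-E   : ∀ {φ ψ} → Derivable L Γ φ → Derivable L Γ (φ ⇒ᵢ ψ) → Derivable L Γ ψ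
  ⊥-E   : ∀ {φ} → L ≡ P⊥ → Derivable L Γ ⊥ᵢ → Derivable L Γ φ
  ⊥w-E  : ∀ {φ ψ} → L ≡ P⊥w → Derivable L Γ ⊥ᵢ → Derivable L Γ (φ ⇒ᵢ ψ) → Derivable L Γ ψ

syntax Derivable L Γ φ = Γ ⊢[ L ] φ

DeductivelyClosed : {At : Set} → Logic → (Infon At → Set) → Set
DeductivelyClosed L T = ∀ ψ → T ⊢[ L ] ψ → T ψ

-- Strings over Σ_⊥ = {0,1,f}

data Sym : Set where
  𝟘 𝟙 𝕗 : Sym

Str : Set
Str = List Sym

fStr : Str
fStr = 𝕗 ∷ []

data IsBit : Sym → Set where
  bit0 : IsBit 𝟘
  bit1 : IsBit 𝟙

InΣ* : Str → Set
InΣ* = All IsBit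

CrackOp : Logic → (Str → Str → Str) → Set
CrackOp P⊥  enc = ⊤
CrackOp P⊥w enc = Σ (Str → Str → Maybe Str) λ crack →
  ∀ a b → crack fStr (enc a b) ≡ just b

record InfonAlgebra (L : Logic) : Set₁ where
  field
    π enc : Str → Str → Str
    l r   : Str → Maybe Str
    dec   : Str → Str → Maybe Str
    l-π     : ∀ x y → l (π x y) ≡ just x
    r-π     : ∀ x y → r (π x y) ≡ just y
    dec-enc : ∀ x y → dec x (enc x y) ≡ just y
    π-Σ*   : ∀ {x y} → InΣ* x → InΣ* y → InΣ* (π x y)
    enc-Σ* : ∀ {x y} → InΣ* x → InΣ* y → InΣ* (enc x y)
    l-Σ*   : ∀ {x y} → InΣ* x → l x ≡ just y → InΣ* y
    r-Σ*   : ∀ {x y} → InΣ* x → r x ≡ just y → InΣ* y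
    dec-Σ* : ∀ {x y z} → InΣ* x → InΣ* y → dec x y ≡ just z → InΣ* z
    E      : Str → Set
    E-nonempty : ∃ E
    E-Σ*   : ∀ {x} → E x → InΣ* x
    crack  : CrackOp L enc

record Interpretation (L : Logic) (At : Set) : Set₁ where
  field
    𝒜    : InfonAlgebra L
    vAt  : At → Str
    vAt-Σ* : ∀ p → InΣ* (vAt p)
    v⊤   : Str
    v⊤-E : InfonAlgebra.E 𝒜 v⊤

  open InfonAlgebra 𝒜

  v : Infon At → Str
  v ⊤ᵢ        = v⊤
  v ⊥ᵢ        = fStr
  v (atom p)  = vAt p
  v (φ ∧ᵢ ψ)  = π (v φ) (v ψ)
  v (φ ⇒ᵢ ψ)  = enc (v φ) (v ψ)

ImageSub : {L : Logic} {At : Set} → Interpretation L At →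
           (Infon At → Set) → (Str → Set) → Set
ImageSub I Γ M = ∀ ψ → Γ ψ → M (Interpretation.v I ψ)

LClosed : {L : Logic} → InfonAlgebra L → (Str → Set) → Set
LClosed {L} 𝒜 M =
    (∀ x → E x → M x)
  × (∀ a b → (M a × M b) ⇔ M (π a b))
  × (∀ a b → M a → M (enc a b) → M b)
  × (∀ a b → M b → M (enc a b))
  × Cond L
  where
    open InfonAlgebra 𝒜
    Cond : Logic → Set
    Cond P⊥  = M fStr → ∀ x → M x
    Cond P⊥w = ∀ a b → M fStr → M (enc a b) → M b

InLeastClosed : {L : Logic} → InfonAlgebra L → (Str → Set) → Str → Set₁
InLeastClosed 𝒜 S x = ∀ (M : Str → Set) → LClosed 𝒜 M → (∀ y → S y → M y) → M x

Injective : {L : Logic} {At : Set} → Interpretation L At → Set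
Injective I = ∀ φ ψ → v φ ≡ v ψ → φ ≡ ψ
  where open Interpretation I

Conservative : {L : Logic} {At : Set} → Interpretation L At → Set₁
Conservative {L} {At} I =
  ∀ (T : Infon At → Set) → DeductivelyClosed L T →
  ∀ ψ → ¬ T ψ →
  ¬ InLeastClosed 𝒜 (λ s → Σ (Infon At) λ χ → T χ × v χ ≡ s) (v ψ)
  where open Interpretation I

Plain : {L : Logic} {At : Set} → Interpretation L At → Set₁
Plain I = Injective I × Conservative I

module Submission where

open import Defs
open import Data.Product using (Σ; _×_; _,_; proj₁; proj₂)
open import Relation.Nullary using (¬_)
open import Relation.Binary.PropositionalEquality using (_≡_; refl)
open import Function.Bundles using (mk⇔; Equivalence)

-- Take for M the least L-closed set containing the image of the theory of Γ.
-- The theory of Γ is deductively closed, so conservativity of I says that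
-- this least closed set contains v(φ) only for φ in the theory, i.e. for
-- derivable φ.

⊢-cut : ∀ {At L} {Γ Δ : Infon At → Set} →
        (∀ {χ} → Δ χ → Γ ⊢[ L ] χ) → ∀ {φ} → Δ ⊢[ L ] φ → Γ ⊢[ L ] φ
⊢-cut Δ⊆Γ (hyp δ)      = Δ⊆Γ δ
⊢-cut Δ⊆Γ top          = top
⊢-cut Δ⊆Γ (∧-I d e)    = ∧-I (⊢-cut Δ⊆Γ d) (⊢-cut Δ⊆Γ e)
⊢-cut Δ⊆Γ (∧-E₁ d)     = ∧-E₁ (⊢-cut Δ⊆Γ d)
⊢-cut Δ⊆Γ (∧-E₂ d)     = ∧-E₂ (⊢-cut Δ⊆Γ d)
⊢-cut Δ⊆Γ (⇒-I d)      = ⇒-I (⊢-cut Δ⊆Γ d)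
⊢-cut Δ⊆Γ (⇒-E d e)    = ⇒-E (⊢-cut Δ⊆Γ d) (⊢-cut Δ⊆Γ e)
⊢-cut Δ⊆Γ (⊥-E p d)    = ⊥-E p (⊢-cut Δ⊆Γ d)
⊢-cut Δ⊆Γ (⊥w-E p d e) = ⊥w-E p (⊢-cut Δ⊆Γ d) (⊢-cut Δ⊆Γ e)

theory-deductivelyClosed : ∀ {At} L (Γ : Infon At → Set) →
                           DeductivelyClosed L (Derivable L Γ)
theory-deductivelyClosed L Γ ψ = ⊢-cut (λ d → d)

Image : {A : Set} → (A → Str) → (A → Set) → Str → Set
Image {A} v T s = Σ A λ χ → T χ × v χ ≡ s

module _ {L : Logic} (𝒜 : InfonAlgebra L) where
  open InfonAlgebra 𝒜

  data Closure (S : Str → Set) : Str → Set where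
    gen   : ∀ {x} → S x → Closure S x
    unit  : ∀ {x} → E x → Closure S x
    pair  : ∀ {a b} → Closure S a → Closure S b → Closure S (π a b)
    left  : ∀ {a b} → Closure S (π a b) → Closure S a
    right : ∀ {a b} → Closure S (π a b) → Closure S b
    mp    : ∀ {a b} → Closure S a → Closure S (enc a b) → Closure S b
    wk    : ∀ {a b} → Closure S b → Closure S (enc a b)
    ex    : ∀ {x} → L ≡ P⊥ → Closure S fStr → Closure S x
    exw   : ∀ {a b} → L ≡ P⊥w → Closure S fStr → Closure S (enc a b) → Closure S b

  Closure-least : ∀ {S x} → Closure S x → InLeastClosed 𝒜 S x
  Closure-least {S} g M (E⊆M , π⇔ , mpM , wkM , botM) S⊆M = go g
    where
      go : ∀ {x} → Closure S x → M x
      go (gen s)         = S⊆M _ s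
      go (unit e)        = E⊆M _ e
      go (pair g h)      = Equivalence.to (π⇔ _ _) (go g , go h)
      go (left g)        = proj₁ (Equivalence.from (π⇔ _ _) (go g))
      go (right g)       = proj₂ (Equivalence.from (π⇔ _ _) (go g))
      go (mp g h)        = mpM _ _ (go g) (go h)
      go (wk g)          = wkM _ _ (go g)
      go (ex refl g)     = botM (go g) _
      go (exw refl g h)  = botM _ _ (go g) (go h)

Closure-closed : ∀ {L} (𝒜 : InfonAlgebra L) S → LClosed 𝒜 (Closure 𝒜 S)
Closure-closed {P⊥} 𝒜 S =
  (λ x → unit) , (λ a b → mk⇔ (λ (g , h) → pair g h) (λ g → left g , right g)) ,
  (λ a b → mp) , (λ a b → wk) , (λ f x → ex refl f)
Closure-closed {P⊥w} 𝒜 S =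
  (λ x → unit) , (λ a b → mk⇔ (λ (g , h) → pair g h) (λ g → left g , right g)) ,
  (λ a b → mp) , (λ a b → wk) , (λ a b → exw refl)

theorem4 : (L : Logic) (At : Set) (I : Interpretation L At) → Plain I →
    (Γ : Infon At → Set) →
    Σ (Str → Set) λ M →
    LClosed (Interpretation.𝒜 I) M
    × ImageSub I Γ M
    × (∀ φ → ¬ (Γ ⊢[ L ] φ) → ¬ M (Interpretation.v I φ))
theorem4 L At I (_ , conservative) Γ =
  M , Closure-closed 𝒜 S , (λ ψ γ → gen (ψ , hyp γ , refl)) ,
  λ φ Γ⊬φ vφ∈M →
    conservative Th (theory-deductivelyClosed L Γ) φ Γ⊬φ (Closure-least 𝒜 vφ∈M)
  where
    open Interpretation I
    Th : Infon At → Set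
    Th = Derivable L Γ
    S : Str → Set
    S = Image v Th
    M : Str → Set
    M = Closure 𝒜 S
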